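{- Let $k$ and $r$ be positive integers such that $r \mid k$ and $k > r$. Then $S_{\mathfrak{z},2}(k;r) = rk - 2r + 1$.
   Context: Let $\mathcal{E}$ denote the equation $x_1 + x_2 + \cdots + x_{k-1} = x_k$ in positive integers. For positive integers $k, r$ with $r \mid k$, $S_{\mathfrak{z},2}(k;r)$ is defined as the least positive integer $t$ such that for every 2-coloring $\chi : \{1, 2, \ldots, t\} \to \{0,1\}$ there exists a solution $(\hat{x}_1, \ldots, \hat{x}_k)$ of $\mathcal{E}$ with all $\hat{x}_i \in \{1,\ldots,t\}$ satisfying $\sum_{i=1}^k \chi(\hat{x}_i) \equiv 0 \pmod{r}$. -}

module Defs where

open import Data.Nat using (ℕ; zero; suc; _+_; _*_; _∸_; _≤_; _<_)
open import Data.Nat.Divisibility using (_∣_)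
open import Data.Fin using (Fin; toℕ; fromℕ; inject₁)
open import Data.Product using (Σ; _×_; ∃)
open import Data.Empty using (⊥)
open import Relation.Binary.PropositionalEquality using (_≡_)

Σ[<_]_ : (n : ℕ) → (Fin n → ℕ) → ℕ
Σ[< zero ] f = 0
Σ[< suc n ] f = f Data.Fin.zero + Σ[< n ] (λ i → f (Data.Fin.suc i))

-- A 2-coloring of the positive integers (only values on 1..t are relevant).
Coloring : Set
Coloring = ℕ → Fin 2

-- x : Fin (suc m) → ℕ is a solution of x_1 + ... + x_m = x_{m+1}
-- (here k = m + 1; the last index is fromℕ m) in {1,...,t},
-- whose color sum is divisible by r.
IsZeroSumSolution : (m r t : ℕ) → Coloring → (Fin (suc m) → ℕ) → Set
IsZeroSumSolution m r t χ x =
  (∀ i → 1 ≤ x i × x i ≤ t)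
  × (Σ[< m ] (λ i → x (inject₁ i)) ≡ x (fromℕ m))
  × (r ∣ Σ[< suc m ] (λ i → toℕ (χ (x i))))

Good : (m r t : ℕ) → Set
Good m r t = ∀ (χ : Coloring) → ∃ λ x → IsZeroSumSolution m r t χ x

SIsValue : (k r s : ℕ) → Set
SIsValue zero r s = ⊥
SIsValue (suc m) r s = (1 ≤ s) × Good m r s × (∀ t → 1 ≤ t → Good m r t → s ≤ t)

module Submission where

open import Defs
open import Data.Nat using (ℕ; zero; suc; _+_; _*_; _∸_; _≤_; _<_; z≤n; s≤s; s≤s⁻¹; _<?_)
open import Data.Nat.Properties
open import Algebra.Properties.CommutativeSemigroup +-commutativeSemigroup using (interchange)
open import Data.Nat.ListAction using (sum)
open import Data.Nat.Divisibility
  using (_∣_; _∤_; _∣?_; divides; ∣-refl; ∣-reflexive; _∣0; 1∣_; ∣-trans; ∣m+n∣m⇒∣n; ∣m∣n⇒∣m+n; m∣m*n; ∣⇒≤; >⇒∤)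
open import Data.Nat.Tactic.RingSolver using (solve-∀)
open import Relation.Nullary using (yes; no; contradiction)
open import Data.Fin using (Fin; toℕ; fromℕ; inject₁; opposite) renaming (zero to fzero; suc to fsuc)
open import Data.List using (List; []; _∷_; length; map; replicate; _++_)
open import Data.List.Properties using (map-++; map-id; length-++; length-replicate)
open import Data.Nat.ListAction.Properties using (sum-++)
open import Data.List.Relation.Unary.All as All using (All; []; _∷_)
open import Data.List.Relation.Unary.All.Properties using (++⁺; replicate⁺)
open import Data.Product using (∃; _×_; _,_; proj₁; proj₂)
open import Data.Sum using (_⊎_; inj₁; inj₂; [_,_]′)
open import Relation.Binary.PropositionalEquality
  using (_≡_; _≢_; refl; sym; trans; cong; cong₂; subst; subst₂; module ≡-Reasoning)
open import Function using (_∘_)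

-- Write k = n + 2 and c = colour χ.
--
-- Lower bound: colour v by 1 exactly when v > n.  Every summand then satisfies x ≥ 1 + n·c(x),
-- so the total exceeds n and is coloured 1; a zero-sum solution therefore has at least r − 1
-- coloured summands, and its total is at least (n + 1) + n(r − 1) = rn + 1.
--
-- Upper bound, t = rn + 1: passing from χ to 1 − χ changes the colour sum of a solution by k,
-- a multiple of r, so we may assume c(1) = 0.  The solutions (1ⁿ⁺¹ | n+1), ((n+1)ʳ⁻¹, 1ⁿ⁺²⁻ʳ | t)
-- and (1, rⁿ | t) handle the cases c(n+1) = 0, c(t) = 1 and c(r) = 0.  Otherwise look for a break
-- u ≥ 2, where c(u+1) and c(u) + c(2) differ by one: the solutions (r^q, u+1, 1^(s+1) | X) and
-- (r^q, u, 2, 1^s | X) have the same total X and, for the right q, colour counts r − 1 and r in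
-- some order, so one of them is zero-sum whatever c(X) is.  Without a break c(j) ≡ (j − 1)·c(2)
-- (mod 2) for all j ≥ 2, which c(r) = 1 contradicts when r is odd or c(2) = 0, and c(n+1) = 1
-- contradicts when n + 1 is odd; since r ∣ n + 2, one of these applies.

colour : Coloring → ℕ → ℕ
colour χ v = toℕ (χ v)

Σ-complement : ∀ n (f g : Fin n → ℕ) → (∀ i → f i + g i ≡ 1) → Σ[< n ] f + Σ[< n ] g ≡ n
Σ-complement zero f g fg≡1 = refl
Σ-complement (suc n) f g fg≡1 = begin
  (f fzero + Σ[< n ] (f ∘ fsuc)) + (g fzero + Σ[< n ] (g ∘ fsuc))  ≡⟨ interchange (f fzero) _ _ _ ⟩
  (f fzero + g fzero) + (Σ[< n ] (f ∘ fsuc) + Σ[< n ] (g ∘ fsuc))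
    ≡⟨ cong₂ _+_ (fg≡1 fzero) (Σ-complement n (f ∘ fsuc) (g ∘ fsuc) (fg≡1 ∘ fsuc)) ⟩
  suc n                                                            ∎
  where open ≡-Reasoning

colour-opposite : ∀ χ v → colour (opposite ∘ χ) v + colour χ v ≡ 1
colour-opposite χ v with χ v
... | fzero = refl
... | fsuc fzero = refl

solution-opposite : ∀ {m r t} χ {x} → r ∣ suc m →
  IsZeroSumSolution m r t (opposite ∘ χ) x → IsZeroSumSolution m r t χ x
solution-opposite {m} {r} χ {x} r∣k (bounds , total , r∣opp) = bounds , total , ∣m+n∣m⇒∣n r∣sum r∣opp
  where
  r∣sum : r ∣ Σ[< suc m ] (λ i → colour (opposite ∘ χ) (x i)) + Σ[< suc m ] (λ i → colour χ (x i))
  r∣sum = subst (r ∣_) (sym (Σ-complement (suc m) (colour (opposite ∘ χ) ∘ x) (colour χ ∘ x) (colour-opposite χ ∘ x))) r∣k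

Good-from-normalised : ∀ {m r t} → r ∣ suc m →
  (∀ χ → χ 1 ≡ fzero → ∃ (IsZeroSumSolution m r t χ)) → Good m r t
Good-from-normalised r∣k normalised χ with χ 1 in χ1
... | fzero = normalised χ χ1
... | fsuc fzero = let x , sol = normalised (opposite ∘ χ) (cong opposite χ1) in x , solution-opposite χ r∣k sol

Σ-last : ∀ n (f : Fin (suc n) → ℕ) → Σ[< suc n ] f ≡ Σ[< n ] (f ∘ inject₁) + f (fromℕ n)
Σ-last zero f = +-comm (f fzero) 0
Σ-last (suc n) f = trans (cong (f fzero +_) (Σ-last n (f ∘ fsuc))) (sym (+-assoc (f fzero) _ _))

Σ-affine-≤ : ∀ m n (f g : Fin m → ℕ) → (∀ i → 1 + n * g i ≤ f i) → m + n * Σ[< m ] g ≤ Σ[< m ] f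
Σ-affine-≤ zero n f g g≤f = ≤-reflexive (*-zeroʳ n)
Σ-affine-≤ (suc m) n f g g≤f = begin
  suc m + n * (g fzero + Σ[< m ] (g ∘ fsuc))          ≡⟨ cong (suc m +_) (*-distribˡ-+ n (g fzero) _) ⟩
  suc m + (n * g fzero + n * Σ[< m ] (g ∘ fsuc))     ≡⟨ interchange 1 m (n * g fzero) _ ⟩
  (1 + n * g fzero) + (m + n * Σ[< m ] (g ∘ fsuc))
    ≤⟨ +-mono-≤ (g≤f fzero) (Σ-affine-≤ m n (f ∘ fsuc) (g ∘ fsuc) (g≤f ∘ fsuc)) ⟩
  f fzero + Σ[< m ] (f ∘ fsuc)                        ∎
  where open ≤-Reasoning

above : ℕ → Coloring
above n v with n <? v
... | yes _ = fsuc fzero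
... | no _ = fzero

colour-above : ∀ n v → n < v → colour (above n) v ≡ 1
colour-above n v n<v with n <? v
... | yes _ = refl
... | no n≮v = contradiction n<v n≮v

1+n*colour-above≤ : ∀ n v → 1 ≤ v → 1 + n * colour (above n) v ≤ v
1+n*colour-above≤ n v 1≤v with n <? v
... | yes n<v = subst (_≤ v) (cong suc (sym (*-identityʳ n))) n<v
... | no _ = subst (_≤ v) (cong suc (sym (*-zeroʳ n))) 1≤v

lower-bound : ∀ {n r t} → Good (suc n) r t → r * n + 1 ≤ t
lower-bound {n} {r} {t} good with good (above n)
... | x , bounds , total , r∣Σ = begin
  r * n + 1                ≡⟨ cong (_+ 1) (*-comm r n) ⟩
  n * r + 1                ≤⟨ +-monoˡ-≤ 1 (*-monoʳ-≤ n r≤1+coloured) ⟩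
  n * suc coloured + 1            ≡⟨ trans (cong (_+ 1) (*-suc n coloured)) (+-comm _ 1) ⟩
  suc n + n * coloured            ≤⟨ last≥ ⟩
  x (fromℕ (suc n))        ≤⟨ proj₂ (bounds (fromℕ (suc n))) ⟩
  t                        ∎
  where
  open ≤-Reasoning
  coloured : ℕ
  coloured = Σ[< suc n ] (λ i → colour (above n) (x (inject₁ i)))
  last≥ : suc n + n * coloured ≤ x (fromℕ (suc n))
  last≥ = subst (suc n + n * coloured ≤_) total
    (Σ-affine-≤ (suc n) n (x ∘ inject₁) (colour (above n) ∘ x ∘ inject₁)
      (λ i → 1+n*colour-above≤ n _ (proj₁ (bounds (inject₁ i)))))
  total-colour : Σ[< suc (suc n) ] (λ i → colour (above n) (x i)) ≡ suc coloured
  total-colour = trans (Σ-last (suc n) (colour (above n) ∘ x))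
    (trans (cong (coloured +_) (colour-above n _ (≤-trans (m≤m+n (suc n) _) last≥))) (+-comm coloured 1))
  r≤1+coloured : r ≤ suc coloured
  r≤1+coloured = ∣⇒≤ (subst (r ∣_) total-colour r∣Σ)

colourSum : Coloring → List ℕ → ℕ
colourSum χ L = sum (map (colour χ) L)

_▹_ : (L : List ℕ) → ℕ → Fin (suc (length L)) → ℕ
([] ▹ a) _ = a
((x ∷ L) ▹ a) fzero = x
((x ∷ L) ▹ a) (fsuc i) = (L ▹ a) i

Σ-▹-inject₁ : ∀ L a → Σ[< length L ] (λ i → (L ▹ a) (inject₁ i)) ≡ sum L
Σ-▹-inject₁ [] a = refl
Σ-▹-inject₁ (x ∷ L) a = cong (x +_) (Σ-▹-inject₁ L a)

▹-fromℕ : ∀ L a → (L ▹ a) (fromℕ (length L)) ≡ a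
▹-fromℕ [] a = refl
▹-fromℕ (x ∷ L) a = ▹-fromℕ L a

Σ-map-▹ : ∀ (f : ℕ → ℕ) L a → Σ[< suc (length L) ] (λ i → f ((L ▹ a) i)) ≡ sum (map f L) + f a
Σ-map-▹ f [] a = +-comm (f a) 0
Σ-map-▹ f (x ∷ L) a = trans (cong (f x +_) (Σ-map-▹ f L a)) (sym (+-assoc (f x) _ _))

All-▹ : ∀ {P : ℕ → Set} {L a} → All P L → P a → ∀ i → P ((L ▹ a) i)
All-▹ [] pa _ = pa
All-▹ (px ∷ _) pa fzero = px
All-▹ (_ ∷ pxs) pa (fsuc i) = All-▹ pxs pa i

All-≤-sum : ∀ L → All (_≤ sum L) L
All-≤-sum [] = []
All-≤-sum (x ∷ L) = m≤m+n x (sum L) ∷ All.map (λ {y} y≤ → ≤-trans y≤ (m≤n+m (sum L) x)) (All-≤-sum L)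

length≤sum : ∀ {L} → All (1 ≤_) L → length L ≤ sum L
length≤sum [] = z≤n
length≤sum (1≤x ∷ ps) = +-mono-≤ 1≤x (length≤sum ps)

list-solution : ∀ {m r t} χ L → length L ≡ suc m → All (1 ≤_) L → sum L ≤ t →
  r ∣ colourSum χ L + colour χ (sum L) → ∃ (IsZeroSumSolution (suc m) r t χ)
list-solution {r = r} {t} χ L len pos sum≤t r∣ =
  subst (λ m → ∃ (IsZeroSumSolution m r t χ)) len (L ▹ sum L , bounds , total , r∣Σ)
  where
  1≤sum : 1 ≤ sum L
  1≤sum = ≤-trans (subst (1 ≤_) (sym len) (s≤s z≤n)) (length≤sum pos)
  bounds : ∀ i → 1 ≤ (L ▹ sum L) i × (L ▹ sum L) i ≤ t
  bounds = All-▹ (All.map (λ (1≤x , x≤s) → 1≤x , ≤-trans x≤s sum≤t) (All.zip (pos , All-≤-sum L)))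
                 (1≤sum , sum≤t)
  total : Σ[< length L ] (λ i → (L ▹ sum L) (inject₁ i)) ≡ (L ▹ sum L) (fromℕ (length L))
  total = trans (Σ-▹-inject₁ L (sum L)) (sym (▹-fromℕ L (sum L)))
  r∣Σ : r ∣ Σ[< suc (length L) ] (λ i → colour χ ((L ▹ sum L) i))
  r∣Σ = subst (r ∣_) (sym (Σ-map-▹ (colour χ) L (sum L))) r∣

expand : List (ℕ × ℕ) → List ℕ
expand [] = []
expand ((m , v) ∷ bs) = replicate m v ++ expand bs

size : List (ℕ × ℕ) → ℕ
size bs = sum (map proj₁ bs)

weight : (ℕ → ℕ) → List (ℕ × ℕ) → ℕ
weight f bs = sum (map (λ (m , v) → m * f v) bs)

length-expand : ∀ bs → length (expand bs) ≡ size bs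
length-expand [] = refl
length-expand ((m , v) ∷ bs) =
  trans (length-++ (replicate m v)) (cong₂ _+_ (length-replicate m) (length-expand bs))

sum-map-replicate : ∀ (f : ℕ → ℕ) m v → sum (map f (replicate m v)) ≡ m * f v
sum-map-replicate f zero v = refl
sum-map-replicate f (suc m) v = cong (f v +_) (sum-map-replicate f m v)

sum-map-expand : ∀ f bs → sum (map f (expand bs)) ≡ weight f bs
sum-map-expand f [] = refl
sum-map-expand f ((m , v) ∷ bs) = begin
  sum (map f (replicate m v ++ expand bs))               ≡⟨ cong sum (map-++ f (replicate m v) (expand bs)) ⟩
  sum (map f (replicate m v) ++ map f (expand bs))       ≡⟨ sum-++ (map f (replicate m v)) _ ⟩
  sum (map f (replicate m v)) + sum (map f (expand bs))  ≡⟨ cong₂ _+_ (sum-map-replicate f m v) (sum-map-expand f bs) ⟩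
  m * f v + weight f bs                                  ∎
  where open ≡-Reasoning

sum-expand : ∀ bs → sum (expand bs) ≡ weight (λ v → v) bs
sum-expand bs = trans (cong sum (sym (map-id (expand bs)))) (sum-map-expand (λ v → v) bs)

All-expand : ∀ {P : ℕ → Set} {bs} → All (λ b → P (proj₂ b)) bs → All P (expand bs)
All-expand [] = []
All-expand {bs = (m , v) ∷ _} (pv ∷ ps) = ++⁺ (replicate⁺ m pv) (All-expand ps)

blocks-solution : ∀ {m r t} χ bs {X N} → All (λ b → 1 ≤ proj₂ b) bs → size bs ≡ suc m →
  weight (λ v → v) bs ≡ X → X ≤ t → weight (colour χ) bs ≡ N → r ∣ N + colour χ X →
  ∃ (IsZeroSumSolution (suc m) r t χ)
blocks-solution {r = r} {t} χ bs pos len refl X≤t refl r∣ =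
  list-solution χ (expand bs) (trans (length-expand bs) len) (All-expand pos)
    (subst (_≤ t) (sym (sum-expand bs)) X≤t)
    (subst₂ (λ N X → r ∣ N + colour χ X) (sym (sum-map-expand (colour χ) bs)) (sym (sum-expand bs)) r∣)

-- The sum is at most 3, so it is odd exactly when c(u+1) and c(u) + c(2) differ by one.
Break : Coloring → ℕ → Set
Break χ u = 2 ∤ colour χ u + colour χ 2 + colour χ (suc u)

parity-step : ∀ a b c z → 2 ∣ a + z → 2 ∣ a + b + c → 2 ∣ c + (b + z)
parity-step a b c z 2∣a+z 2∣a+b+c =
  ∣m+n∣m⇒∣n (subst (2 ∣_) (regroup a b c z) (∣m∣n⇒∣m+n 2∣a+z 2∣a+b+c)) (m∣m*n a)
  where
  regroup : ∀ a b c z → (a + z) + (a + b + c) ≡ 2 * a + (c + (b + z))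
  regroup = solve-∀

break-or-parity : ∀ χ i →
  (∃ λ u → 2 ≤ u × u < 2 + i × Break χ u) ⊎ 2 ∣ colour χ (2 + i) + (3 + i) * colour χ 2
break-or-parity χ zero = inj₂ (∣-trans (divides 2 refl) (m∣m*n (colour χ 2)))
break-or-parity χ (suc i) with break-or-parity χ i
... | inj₁ (u , 2≤u , u<j , brk) = inj₁ (u , 2≤u , m≤n⇒m≤1+n u<j , brk)
... | inj₂ even with 2 ∣? colour χ (2 + i) + colour χ 2 + colour χ (3 + i)
...   | yes no-break = inj₂ (parity-step (colour χ (2 + i)) (colour χ 2) (colour χ (3 + i)) _ even no-break)
...   | no brk = inj₁ (2 + i , s≤s (s≤s z≤n) , ≤-refl , brk)

parity-without-break : ∀ N (c : Fin 2) → 2 ∣ 1 + suc N * toℕ c → toℕ c ≡ 1 × 2 ∣ N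
parity-without-break N fzero 2∣1 =
  contradiction (subst (2 ∣_) (cong suc (*-zeroʳ N)) 2∣1) (>⇒∤ (s≤s (s≤s z≤n)))
parity-without-break N (fsuc fzero) 2∣N+2 =
  refl , ∣m+n∣m⇒∣n (subst (2 ∣_) (cong (λ z → suc (suc z)) (*-identityʳ N)) 2∣N+2) ∣-refl

break-below : ∀ χ N → 2 ≤ N → colour χ N ≡ 1 → colour χ 2 ≡ 0 ⊎ 2 ∤ N →
  ∃ λ u → 2 ≤ u × u < N × Break χ u
break-below χ (suc zero) (s≤s ()) _ _
break-below χ (suc (suc i)) _ cN≡1 c2≡0⊎N-odd with break-or-parity χ i
... | inj₁ brk = brk
... | inj₂ even with parity-without-break (2 + i) (χ 2) (subst (λ c → 2 ∣ c + (3 + i) * colour χ 2) cN≡1 even)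
...   | c2≡1 , 2∣N with c2≡0⊎N-odd
...     | inj₁ c2≡0 = contradiction (trans (sym c2≡1) c2≡0) λ ()
...     | inj₂ N-odd = contradiction 2∣N N-odd

Consecutive : ℕ → ℕ → ℕ → Set
Consecutive m a b = (a ≡ m × b ≡ suc m) ⊎ (a ≡ suc m × b ≡ m)

+-consecutive : ∀ q {m a b} → Consecutive m a b → Consecutive (q + m) (q + a) (q + b)
+-consecutive q {m} (inj₁ (refl , refl)) = inj₁ (refl , +-suc q m)
+-consecutive q {m} (inj₂ (refl , refl)) = inj₂ (+-suc q m , refl)

consecutive-divides : ∀ {m a b} → Consecutive m a b → (x : Fin 2) →
  suc m ∣ a + toℕ x ⊎ suc m ∣ b + toℕ x
consecutive-divides {m} (inj₁ (refl , refl)) fzero = inj₂ (∣-reflexive (sym (+-identityʳ (suc m))))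
consecutive-divides {m} (inj₁ (refl , refl)) (fsuc fzero) = inj₁ (∣-reflexive (+-comm 1 m))
consecutive-divides {m} (inj₂ (refl , refl)) fzero = inj₁ (∣-reflexive (sym (+-identityʳ (suc m))))
consecutive-divides {m} (inj₂ (refl , refl)) (fsuc fzero) = inj₂ (∣-reflexive (+-comm 1 m))

break-consecutive : ∀ (a c b : Fin 2) → 2 ∤ toℕ a + toℕ c + toℕ b →
  (Consecutive 0 (toℕ b) (toℕ a + toℕ c) × (toℕ b ≡ 0 ⊎ toℕ c ≡ 0)) ⊎ Consecutive 1 (toℕ b) (toℕ a + toℕ c)
break-consecutive fzero fzero fzero odd = contradiction (divides 0 refl) odd
break-consecutive fzero fzero (fsuc fzero) _ = inj₁ (inj₂ (refl , refl) , inj₂ refl)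
break-consecutive fzero (fsuc fzero) fzero _ = inj₁ (inj₁ (refl , refl) , inj₁ refl)
break-consecutive fzero (fsuc fzero) (fsuc fzero) odd = contradiction (divides 1 refl) odd
break-consecutive (fsuc fzero) fzero fzero _ = inj₁ (inj₁ (refl , refl) , inj₁ refl)
break-consecutive (fsuc fzero) fzero (fsuc fzero) odd = contradiction (divides 1 refl) odd
break-consecutive (fsuc fzero) (fsuc fzero) fzero odd = contradiction (divides 1 refl) odd
break-consecutive (fsuc fzero) (fsuc fzero) (fsuc fzero) _ = inj₂ (inj₁ (refl , refl))

ones-solution : ∀ {n r t} χ → suc n ≤ t → r ∣ suc n * colour χ 1 + colour χ (suc n) →
  ∃ (IsZeroSumSolution (suc n) r t χ)
ones-solution {n} χ n<t r∣ = blocks-solution χ ((suc n , 1) ∷ []) (s≤s z≤n ∷ [])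
  (+-identityʳ (suc n)) (trans (+-identityʳ _) (*-identityʳ (suc n))) n<t (+-identityʳ _) r∣

two-candidates : ∀ χ {r' q s u lo} → colour χ 1 ≡ 0 → colour χ (suc r') ≡ 1 →
  1 ≤ u → u ≤ r' * suc s → q + lo ≡ r' → Consecutive lo (colour χ (suc u)) (colour χ u + colour χ 2) →
  ∃ (IsZeroSumSolution (suc (q + suc s)) (suc r') (suc r' * (q + suc s) + 1) χ)
two-candidates χ {r'} {q} {s} {u} c1≡0 cr≡1 1≤u u≤r'*s q+lo≡r' cons =
  [ blocks-solution χ A (1≤r ∷ s≤s z≤n ∷ s≤s z≤n ∷ []) (size-A q s) (weight-A q r' u s) X≤t colour-A
  , blocks-solution χ B (1≤r ∷ 1≤u ∷ s≤s z≤n ∷ s≤s z≤n ∷ []) (size-B q s) (weight-B q r' u s) X≤t colour-B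
  ]′ (consecutive-divides (subst (λ m → Consecutive m _ _) q+lo≡r' (+-consecutive q cons)) (χ X))
  where
  r X : ℕ
  r = suc r'
  X = q * r + suc u + suc s
  1≤r : 1 ≤ r
  1≤r = s≤s z≤n
  A B : List (ℕ × ℕ)
  A = (q , r) ∷ (1 , suc u) ∷ (suc s , 1) ∷ []
  B = (q , r) ∷ (1 , u) ∷ (1 , 2) ∷ (s , 1) ∷ []
  size-A : ∀ q s → q + (1 + (suc s + 0)) ≡ suc (q + suc s)
  size-A = solve-∀
  size-B : ∀ q s → q + (1 + (1 + (s + 0))) ≡ suc (q + suc s)
  size-B = solve-∀
  weight-A : ∀ q r' u s → q * suc r' + (1 * suc u + (suc s * 1 + 0)) ≡ q * suc r' + suc u + suc s
  weight-A = solve-∀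
  weight-B : ∀ q r' u s → q * suc r' + (1 * u + (1 * 2 + (s * 1 + 0))) ≡ q * suc r' + suc u + suc s
  weight-B = solve-∀
  colour-A : weight (colour χ) A ≡ q + colour χ (suc u)
  colour-A rewrite cr≡1 | c1≡0 = shift q (colour χ (suc u)) s
    where
    shift : ∀ q a s → q * 1 + (1 * a + (suc s * 0 + 0)) ≡ q + a
    shift = solve-∀
  colour-B : weight (colour χ) B ≡ q + (colour χ u + colour χ 2)
  colour-B rewrite cr≡1 | c1≡0 = shift q (colour χ u) (colour χ 2) s
    where
    shift : ∀ q a b s → q * 1 + (1 * a + (1 * b + (s * 0 + 0))) ≡ q + (a + b)
    shift = solve-∀
  X≤t : X ≤ r * (q + suc s) + 1
  X≤t = begin
    q * r + suc u + suc s                ≤⟨ +-monoˡ-≤ (suc s) (+-monoʳ-≤ (q * r) (s≤s u≤r'*s)) ⟩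
    q * r + suc (r' * suc s) + suc s     ≡⟨ regroup q r' s ⟩
    r * (q + suc s) + 1                  ∎
    where
    open ≤-Reasoning
    regroup : ∀ q r' s → q * suc r' + suc (r' * suc s) + suc s ≡ suc r' * (q + suc s) + 1
    regroup = solve-∀

m+n≤m*[1+n] : ∀ r' s → 1 ≤ r' → r' + s ≤ r' * suc s
m+n≤m*[1+n] r'@(suc _) s _ = subst (r' + s ≤_) (sym (*-suc r' s)) (+-monoʳ-≤ r' (m≤n*m s r'))

module UpperBound (r'' d : ℕ) where

  r' r n t : ℕ
  r' = suc r''
  r = suc r'
  n = r + d
  t = r * n + 1

  Solution : Coloring → Set
  Solution χ = ∃ (IsZeroSumSolution (suc n) r t χ)

  module _ (χ : Coloring) (c1≡0 : colour χ 1 ≡ 0) where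

    all-ones : colour χ (suc n) ≡ 0 → Solution χ
    all-ones cN≡0 = ones-solution χ (subst (_≤ t) (+-comm n 1) (+-monoˡ-≤ 1 (m≤n*m n r))) r∣0
      where
      r∣0 : r ∣ suc n * colour χ 1 + colour χ (suc n)
      r∣0 rewrite c1≡0 | cN≡0 | *-zeroʳ n = r ∣0

    copies-of-n+1 : colour χ (suc n) ≡ 1 → colour χ t ≡ 1 → Solution χ
    copies-of-n+1 cN≡1 ct≡1 =
      blocks-solution χ ((r' , suc n) ∷ (suc (suc d) , 1) ∷ []) (s≤s z≤n ∷ s≤s z≤n ∷ [])
        (size-eq r'' d) (total-eq r'' d) ≤-refl count
        (∣-reflexive (sym (trans (cong (r' +_) ct≡1) (+-comm r' 1))))
      where
      size-eq : ∀ r'' d → suc r'' + (suc (suc d) + 0) ≡ suc (suc (suc r'') + d)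
      size-eq = solve-∀
      total-eq : ∀ r'' d →
        suc r'' * suc (suc (suc r'') + d) + (suc (suc d) * 1 + 0) ≡ suc (suc r'') * (suc (suc r'') + d) + 1
      total-eq = solve-∀
      count : weight (colour χ) ((r' , suc n) ∷ (suc (suc d) , 1) ∷ []) ≡ r'
      count rewrite cN≡1 | c1≡0 = simplify r' d
        where
        simplify : ∀ r' d → r' * 1 + (suc (suc d) * 0 + 0) ≡ r'
        simplify = solve-∀

    copies-of-r : colour χ t ≡ 0 → colour χ r ≡ 0 → Solution χ
    copies-of-r ct≡0 cr≡0 = blocks-solution χ ((1 , 1) ∷ (n , r) ∷ []) (s≤s z≤n ∷ s≤s z≤n ∷ [])
      (cong suc (+-identityʳ n)) (total-eq n r) ≤-refl count (subst (r ∣_) (sym ct≡0) (r ∣0))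
      where
      total-eq : ∀ n r → 1 * 1 + (n * r + 0) ≡ r * n + 1
      total-eq = solve-∀
      count : weight (colour χ) ((1 , 1) ∷ (n , r) ∷ []) ≡ 0
      count rewrite c1≡0 | cr≡0 = cong (_+ 0) (*-zeroʳ n)

    resize : ∀ {m} → n ≡ m → ∃ (IsZeroSumSolution (suc m) r (r * m + 1) χ) → Solution χ
    resize refl sol = sol

    Room : ℕ → Set
    Room u = u < r ⊎ (u < suc n × colour χ (suc n) ≡ 1 × colour χ 2 ≡ 1)

    -- The candidates use q = r − 1 − lo, where lo is the smaller colour count of the break;
    -- the room below the break position gives u ≤ (r − 1)(s + 1), i.e. the total stays ≤ t.
    break-solution : colour χ r ≡ 1 → ∀ u → 2 ≤ u → Break χ u → Room u → Solution χ
    break-solution cr≡1 u 2≤u brk room =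
      [ (λ (cons , cu+1≡0⊎c2≡0) → resize (sym (+-suc r' d))
           (two-candidates χ c1≡0 cr≡1 1≤u (bound₀ room cu+1≡0⊎c2≡0) (+-identityʳ r') cons))
      , (λ cons → resize (sym (trans (+-suc r'' (suc d)) (cong suc (+-suc r'' d))))
           (two-candidates χ c1≡0 cr≡1 1≤u (bound₁ room) (+-comm r'' 1) cons))
      ]′ (break-consecutive (χ u) (χ 2) (χ (suc u)) brk)
      where
      1≤u : 1 ≤ u
      1≤u = ≤-trans (s≤s z≤n) 2≤u
      bound₀ : Room u → colour χ (suc u) ≡ 0 ⊎ colour χ 2 ≡ 0 → u ≤ r' * suc d
      bound₀ (inj₁ u<r) _ = ≤-trans (s≤s⁻¹ u<r) (m≤m*n r' (suc d))
      bound₀ (inj₂ (_ , _ , c2≡1)) (inj₂ c2≡0) = contradiction (trans (sym c2≡1) c2≡0) λ ()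
      bound₀ (inj₂ (u<N , cN≡1 , _)) (inj₁ cu+1≡0) =
        ≤-trans (s≤s⁻¹ (s≤s⁻¹ (≤∧≢⇒< u<N u+1≢N))) (m+n≤m*[1+n] r' d (s≤s z≤n))
        where
        u+1≢N : suc u ≢ suc n
        u+1≢N u+1≡N = contradiction (trans (sym cu+1≡0) (trans (cong (colour χ) u+1≡N) cN≡1)) λ ()
      bound₁ : Room u → u ≤ r' * suc (suc d)
      bound₁ (inj₁ u<r) = ≤-trans (s≤s⁻¹ u<r) (m≤m*n r' (suc (suc d)))
      bound₁ (inj₂ (u<N , _)) =
        ≤-trans (s≤s⁻¹ u<N) (≤-trans (≤-reflexive (sym (+-suc r' d))) (m+n≤m*[1+n] r' (suc d) (s≤s z≤n)))

    break-below-r : colour χ r ≡ 1 → colour χ 2 ≡ 0 ⊎ 2 ∤ r → Solution χ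
    break-below-r cr≡1 c2≡0⊎r-odd with break-below χ r (s≤s (s≤s z≤n)) cr≡1 c2≡0⊎r-odd
    ... | u , 2≤u , u<r , brk = break-solution cr≡1 u 2≤u brk (inj₁ u<r)

    break-below-n+1 : colour χ r ≡ 1 → colour χ (suc n) ≡ 1 → colour χ 2 ≡ 1 → 2 ∤ suc n → Solution χ
    break-below-n+1 cr≡1 cN≡1 c2≡1 N-odd with break-below χ (suc n) (s≤s (s≤s z≤n)) cN≡1 (inj₂ N-odd)
    ... | u , 2≤u , u<N , brk = break-solution cr≡1 u 2≤u brk (inj₂ (u<N , cN≡1 , c2≡1))

    via-break : 2 ∤ r ⊎ 2 ∤ suc n → colour χ r ≡ 1 → colour χ (suc n) ≡ 1 → Solution χ
    via-break parity cr≡1 cN≡1 with χ 2 in χ2 | parity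
    ... | fzero | _ = break-below-r cr≡1 (inj₁ (cong toℕ χ2))
    ... | fsuc fzero | inj₁ r-odd = break-below-r cr≡1 (inj₂ r-odd)
    ... | fsuc fzero | inj₂ N-odd = break-below-n+1 cr≡1 cN≡1 (cong toℕ χ2) N-odd

  normalised-solution : 2 ∤ r ⊎ 2 ∤ suc n → ∀ χ → χ 1 ≡ fzero → Solution χ
  normalised-solution parity χ χ1 with χ (suc n) in χN | χ t in χt | χ r in χr
  ... | fzero | _ | _ = all-ones χ (cong toℕ χ1) (cong toℕ χN)
  ... | fsuc fzero | fsuc fzero | _ = copies-of-n+1 χ (cong toℕ χ1) (cong toℕ χN) (cong toℕ χt)
  ... | fsuc fzero | fzero | fzero = copies-of-r χ (cong toℕ χ1) (cong toℕ χt) (cong toℕ χr)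
  ... | fsuc fzero | fzero | fsuc fzero = via-break χ (cong toℕ χ1) parity (cong toℕ χr) (cong toℕ χN)

m∣n∧m<n⇒m+m≤n : ∀ {r k} → r ∣ k → r < k → r + r ≤ k
m∣n∧m<n⇒m+m≤n {r} (divides (suc zero) refl) r<r+0 =
  contradiction (subst (r <_) (+-identityʳ r) r<r+0) (<-irrefl refl)
m∣n∧m<n⇒m+m≤n {r} (divides (suc (suc q)) refl) _ = +-monoʳ-≤ r (m≤m+n r (q * r))

divisor-parity : ∀ {r n} → r ∣ suc (suc n) → 2 ∤ r ⊎ 2 ∤ suc n
divisor-parity {r} {n} r∣k with 2 ∣? r
... | no r-odd = inj₁ r-odd
... | yes 2∣r = inj₂ λ 2∣n+1 →
  >⇒∤ (s≤s (s≤s z≤n)) (∣m+n∣m⇒∣n (subst (2 ∣_) (+-comm 1 (suc n)) (∣-trans 2∣r r∣k)) 2∣n+1)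

upper-bound : ∀ n r → 1 ≤ r → r ∣ suc (suc n) → r < suc (suc n) → Good (suc n) r (r * n + 1)
upper-bound n 1 _ _ _ χ =
  ones-solution χ (≤-reflexive (trans (+-comm 1 n) (cong (_+ 1) (sym (*-identityˡ n))))) (1∣ _)
upper-bound n r@(suc (suc r'')) _ r∣k r<k
  with m≤n⇒∃[o]m+o≡n (≤-trans (m≤n+m r r'') (s≤s⁻¹ (s≤s⁻¹ (m∣n∧m<n⇒m+m≤n r∣k r<k))))
... | d , refl = Good-from-normalised r∣k (UpperBound.normalised-solution r'' d (divisor-parity r∣k))

r*[2+n]∸2r≡r*n : ∀ r n → r * suc (suc n) ∸ 2 * r ≡ r * n
r*[2+n]∸2r≡r*n r n = trans (cong (_∸ 2 * r) (distribute r n)) (m+n∸m≡n (2 * r) (r * n))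
  where
  distribute : ∀ r n → r * suc (suc n) ≡ 2 * r + r * n
  distribute = solve-∀

theorem3 : (k r : ℕ) → 1 ≤ r → 1 ≤ k → r ∣ k → r < k →
    SIsValue k r ((r * k ∸ 2 * r) + 1)
theorem3 (suc zero) r 1≤r _ _ r<1 = contradiction 1≤r (<⇒≱ r<1)
theorem3 (suc (suc n)) r 1≤r _ r∣k r<k rewrite r*[2+n]∸2r≡r*n r n =
  m≤n+m 1 (r * n) , upper-bound n r 1≤r r∣k r<k , λ t _ good → lower-bound good
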